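{- Let $(X,I,Y,R)$ be a polarity with a relation $R$ of sort type $\sigma=(i_{n+1};i_1\cdots i_n)$ and let $k\in\{1,\ldots,n\}$. The following are equivalent: (1) $\overline\alpha_R$ distributes over arbitrary joins of Galois sets at the $k$-th argument place: for all $F_j\in\mathcal G(Z_{i_j})$ ($j\ne k$) and every family $(G_t)_t$ in $\mathcal G(Z_{i_k})$, $\overline\alpha_R(\vec F[\bigvee_tG_t]_k)=\bigvee_t\overline\alpha_R(\vec F[G_t]_k)$. (2) The map $\overline\gamma^k_R$ defined, for tuples $\vec F$ with $F_j\in\mathcal G(Z_{i_j})$ for $j\neq k$ and $F_k\in\mathcal G(Z_{\overline{i_{n+1}}})$, by $\overline\gamma^k_R(\vec F)=\bigcap\{G\in\mathcal G(Z_{\overline{i_k}}) : \overline\alpha_R(\vec F[G']_k)\subseteq F_k'\}$ is a $k$-conjugate of $\overline\alpha_R$. (3) The map $\overline\beta^k_R$ defined, for $F_j\in\mathcal G(Z_{i_j})$ ($j\ne k$) and $G\in\mathcal G(Z_{i_{n+1}})$, by $\overline\beta^k_R(\vec F[G]_k)=(\overline\gamma^k_R(\vec F[G']_k))'=\bigvee\{H'\,:\,H\in\mathcal G(Z_{\overline{i_k}}),\ \overline\alpha_R(\vec F[H']_k)\subseteq G\}$ is a $k$-residual of $\overline\alpha_R$.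
   Context: A polarity is $(X,I,Y)$, $X,Y$ nonempty, $I\subseteq X\times Y$; $x\perp y$ iff $(x,y)\notin I$; $U^\perp=\{y:x\perp y\ \forall x\in U\}$, ${}^\perp V=\{x:x\perp y\ \forall y\in V\}$. Stable sets $A={}^\perp(A^\perp)\subseteq X$ and co-stable sets $B=({}^\perp B)^\perp\subseteq Y$ (Galois sets) form complete lattices $\mathcal G(X),\mathcal G(Y)$ under inclusion (meets = intersections, joins = Galois closures of unions); $(\cdot)^\perp$ and ${}^\perp(\cdot)$ restrict to mutually inverse order-reversing bijections between them. Priming: $U'=U^\perp$ for $U\subseteq X$, $V'={}^\perp V$ for $V\subseteq Y$. Sorts $Z_1=X$, $Z_\partial=Y$, $\overline1=\partial$, $\overline\partial=1$. A relation of sort $(i_{n+1};i_1\cdots i_n)$ is $R\subseteq Z_{i_{n+1}}\times\prod_jZ_{i_j}$, $R\vec w=\{w:wR\vec w\}$. $\vec F[G]_k$ is $\vec F$ with $k$-th entry replaced by $G$. $\alpha_R(\vec W)=\bigcup\{R\vec w:w_j\in W_j\ \forall j\}$; $\overline\alpha_R(\vec F)=(\alpha_R(\vec F))''$ for $F_j\in\mathcal G(Z_{i_j})$. A $k$-conjugate of $\overline\alpha_R$ is a map $\overline\gamma^k$ on tuples of Galois sets of sort $(i_1,\ldots,i_{k-1},\overline{i_{n+1}},i_{k+1},\ldots,i_n;\overline{i_k})$ such that for all $F_j\in\mathcal G(Z_{i_j})$ and $G\in\mathcal G(Z_{i_{n+1}})$: $\overline\alpha_R(\vec F)\subseteq G$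 iff $\overline\gamma^k(\vec F[G']_k)\subseteq F_k'$. A $k$-residual is a map $\overline\beta^k$ with $\overline\alpha_R(\vec F[H]_k)\subseteq G$ iff $H\subseteq\overline\beta^k(\vec F[G]_k)$ for all $F_j\in\mathcal G(Z_{i_j})$ ($j\ne k$), $H\in\mathcal G(Z_{i_k})$, $G\in\mathcal G(Z_{i_{n+1}})$. -}

module Defs where

open import Level using (Level; 0ℓ; _⊔_) renaming (suc to lsuc)
open import Data.Nat using (ℕ)
open import Data.Fin using (Fin; zero; suc)
open import Data.Product using (Σ; ∃; _×_; _,_)
open import Relation.Nullary using (¬_)
open import Relation.Binary.PropositionalEquality using (_≡_)
open import Relation.Unary using (Pred; _⊆_; _≐_)
open import Function.Bundles using (_⇔_)

record Polarity : Set₁ where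
  field
    X : Set
    Y : Set
    I : X → Y → Set
    x₀ : X
    y₀ : Y

data Sort : Set where
  one ∂ : Sort

bar : Sort → Sort
bar one = ∂
bar ∂ = one

upd : ∀ {a} {n : ℕ} {P : Fin n → Set a} → ((j : Fin n) → P j) → (k : Fin n) → P k → (j : Fin n) → P j
upd f zero x zero = x
upd f zero x (suc j) = f (suc j)
upd f (suc k) x zero = f zero
upd f (suc k) x (suc j) = upd (λ i → f (suc i)) k x j

module _ (P : Polarity) where
  open Polarity P

  _⊥_ : X → Y → Set
  x ⊥ y = ¬ I x y

  Z : Sort → Set
  Z one = X
  Z ∂ = Y

  _^⊥ : ∀ {ℓ} → Pred X ℓ → Pred Y ℓ
  (U ^⊥) y = ∀ x → U x → x ⊥ y

  ⊥^_ : ∀ {ℓ} → Pred Y ℓ → Pred X ℓ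
  (⊥^ V) x = ∀ y → V y → x ⊥ y

  prime : ∀ {ℓ} (i : Sort) → Pred (Z i) ℓ → Pred (Z (bar i)) ℓ
  prime one U = U ^⊥
  prime ∂ V = ⊥^ V

  primeInv : ∀ {ℓ} (i : Sort) → Pred (Z (bar i)) ℓ → Pred (Z i) ℓ
  primeInv one V = ⊥^ V
  primeInv ∂ U = U ^⊥

  cl : ∀ {ℓ} (i : Sort) → Pred (Z i) ℓ → Pred (Z i) ℓ
  cl one U = ⊥^ (U ^⊥)
  cl ∂ V = (⊥^ V) ^⊥

  IsGalois : ∀ {ℓ} (i : Sort) → Pred (Z i) ℓ → Set ℓ
  IsGalois i A = A ≐ cl i A

  ⋁ : (i : Sort) {T : Set} → (T → Pred (Z i) 0ℓ) → Pred (Z i) 0ℓ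
  ⋁ i {T} G = cl i (λ z → Σ T λ t → G t z)

  module WithRelation {n : ℕ} (out : Sort) (is : Fin n → Sort)
                      (R : Z out → ((j : Fin n) → Z (is j)) → Set) where

    Tuple : Set₁
    Tuple = (j : Fin n) → Pred (Z (is j)) 0ℓ

    α : Tuple → Pred (Z out) 0ℓ
    α W w = Σ ((j : Fin n) → Z (is j)) λ ws → ((j : Fin n) → W j (ws j)) × R w ws

    αbar : Tuple → Pred (Z out) 0ℓ
    αbar W = cl out (α W)

    -- γ^k_R(F[E]_k) = ⋂ { G ∈ 𝒢(Z_{bar i_k}) : αbar(F[G']_k) ⊆ E' }
    -- (the k-th entry of F is ignored; E ⊆ Z_{bar out} is the k-th argument)
    γbar : (k : Fin n) → Tuple → Pred (Z (bar out)) 0ℓ → Pred (Z (bar (is k))) (lsuc 0ℓ)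
    γbar k F E z = (G : Pred (Z (bar (is k))) 0ℓ) → IsGalois (bar (is k)) G →
                   αbar (upd F k (primeInv (is k) G)) ⊆ primeInv out E → G z

    βbar : (k : Fin n) → Tuple → Pred (Z out) 0ℓ → Pred (Z (is k)) (lsuc 0ℓ)
    βbar k F G = primeInv (is k) (γbar k F (prime out G))

    Distributes : Fin n → Set₁
    Distributes k = (F : Tuple) → (∀ j → ¬ (j ≡ k) → IsGalois (is j) (F j)) →
      (T : Set) (G : T → Pred (Z (is k)) 0ℓ) → (∀ t → IsGalois (is k) (G t)) →
      αbar (upd F k (⋁ (is k) G)) ≐ ⋁ out (λ t → αbar (upd F k (G t)))

    IsConjugate : Fin n → Set₁
    IsConjugate k =
      ((F : Tuple) → (∀ j → ¬ (j ≡ k) → IsGalois (is j) (F j)) →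
        (E : Pred (Z (bar out)) 0ℓ) → IsGalois (bar out) E →
        IsGalois (bar (is k)) (γbar k F E))
      × ((F : Tuple) → (∀ j → IsGalois (is j) (F j)) →
        (G : Pred (Z out) 0ℓ) → IsGalois out G →
        (αbar F ⊆ G) ⇔ (γbar k F (prime out G) ⊆ prime (is k) (F k)))

    IsResidual : Fin n → Set₁
    IsResidual k =
      ((F : Tuple) → (∀ j → ¬ (j ≡ k) → IsGalois (is j) (F j)) →
        (G : Pred (Z out) 0ℓ) → IsGalois out G →
        IsGalois (is k) (βbar k F G))
      × ((F : Tuple) → (∀ j → ¬ (j ≡ k) → IsGalois (is j) (F j)) →
        (H : Pred (Z (is k)) 0ℓ) → IsGalois (is k) H →
        (G : Pred (Z out) 0ℓ) → IsGalois out G →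
        (αbar (upd F k H) ⊆ G) ⇔ (H ⊆ βbar k F G))

{-# OPTIONS --safe #-}
module Submission where

-- Both (2) and (3) are equivalent to the counit law of the residuation: every Galois set
-- H ⊆ β(F,G) satisfies α(F[H]) ⊆ G. The other half of the residuation law holds in every
-- polarity (H' is one of the sets intersected in γ(F,G')), β = γ' is Galois by construction,
-- and γ ⊆ H' iff H ⊆ γ' is the basic Galois connection of the polarity. Under the counit law
-- H ↦ α(F[H]) is a lower adjoint and so preserves joins. Conversely, distributivity over the
-- join of the principal Galois sets {u}'' sent into G yields the counit law.

open import Defs
open import Level using (0ℓ)
open import Data.Nat using (ℕ)
open import Data.Fin using (Fin; zero; suc)
open import Data.Fin.Properties using (suc-injective)
open import Data.Product using (_×_; Σ; _,_; proj₁; proj₂)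
open import Function.Base using (id; _∘_)
open import Function.Bundles using (_⇔_; mk⇔; Equivalence)
open import Function.Construct.Composition using (_⇔-∘_)
open import Function.Construct.Symmetry using (⇔-sym)
open import Relation.Nullary using (contradiction)
open import Relation.Binary.PropositionalEquality using (_≡_; _≢_; refl; sym; subst)
open import Relation.Unary using (Pred; _⊆_; _≐_; ｛_｝)

upd-pointwise : ∀ {a b} {n : ℕ} {P : Fin n → Set a} (Q : ∀ j → P j → P j → Set b)
                {f g : ∀ j → P j} (k : Fin n) {x y : P k} →
                (∀ j → j ≢ k → Q j (f j) (g j)) → Q k x y →
                ∀ j → Q j (upd f k x j) (upd g k y j)
upd-pointwise Q zero    away at zero    = at
upd-pointwise Q zero    away at (suc j) = away (suc j) λ ()
upd-pointwise Q (suc k) away at zero    = away zero λ ()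
upd-pointwise Q {f} {g} (suc k) away at (suc j) =
  upd-pointwise (Q ∘ suc) {f ∘ suc} {g ∘ suc} k
                (λ j j≢k → away (suc j) (j≢k ∘ suc-injective)) at j

upd-elim : ∀ {a b} {n : ℕ} {P : Fin n → Set a} (Q : ∀ j → P j → Set b)
           {f : ∀ j → P j} (k : Fin n) {x : P k} →
           (∀ j → j ≢ k → Q j (f j)) → Q k x → ∀ j → Q j (upd f k x j)
upd-elim Q {f} k {x} = upd-pointwise (λ j u _ → Q j u) {f} {f} k {x} {x}

upd-updates : ∀ {a} {n : ℕ} {P : Fin n → Set a} (f : ∀ j → P j) (k : Fin n) (x : P k) →
              upd f k x k ≡ x
upd-updates f zero    x = refl
upd-updates f (suc k) x = upd-updates (f ∘ suc) k x

module _ {ℓ} {n : ℕ} {A : Fin n → Set} (F : ∀ j → Pred (A j) ℓ) (k : Fin n) where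

  upd-mono : {U V : Pred (A k) ℓ} → U ⊆ V → ∀ j → upd F k U j ⊆ upd F k V j
  upd-mono = upd-pointwise (λ _ U V → U ⊆ V) k (λ _ _ → id)

  upd-self-⊆ : ∀ j → upd F k (F k) j ⊆ F j
  upd-self-⊆ = upd-elim (λ j U → U ⊆ F j) k (λ _ _ → id) id

  upd-self-⊇ : ∀ j → F j ⊆ upd F k (F k) j
  upd-self-⊇ = upd-elim (λ j U → F j ⊆ U) k (λ _ _ → id) id

  upd-away-⊆ : (U : Pred (A k) ℓ) → ∀ j → j ≢ k → upd F k U j ⊆ F j
  upd-away-⊆ U = upd-elim (λ j V → j ≢ k → V ⊆ F j) k (λ _ _ _ → id)
                          (λ k≢k → contradiction refl k≢k)

module _ (P : Polarity) where

  prime-antitone : ∀ {a b} s {U : Pred (Z P s) a} {V : Pred (Z P s) b} →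
                   U ⊆ V → prime P s V ⊆ prime P s U
  prime-antitone one U⊆V V⊥z z u = V⊥z z (U⊆V u)
  prime-antitone ∂   U⊆V V⊥z z u = V⊥z z (U⊆V u)

  primeInv-antitone : ∀ {a b} s {U : Pred (Z P (bar s)) a} {V : Pred (Z P (bar s)) b} →
                      U ⊆ V → primeInv P s V ⊆ primeInv P s U
  primeInv-antitone one U⊆V V⊥z z u = V⊥z z (U⊆V u)
  primeInv-antitone ∂   U⊆V V⊥z z u = V⊥z z (U⊆V u)

  galois-connection : ∀ {a b} s {U : Pred (Z P s) a} {V : Pred (Z P (bar s)) b} →
                      (V ⊆ prime P s U) ⇔ (U ⊆ primeInv P s V)
  galois-connection one = mk⇔ (λ h {x} u z v → h v x u) (λ h {x} v z u → h u x v)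
  galois-connection ∂   = mk⇔ (λ h {x} u z v → h v x u) (λ h {x} v z u → h u x v)

  cl≐primeInv∘prime : ∀ {a} s {U : Pred (Z P s) a} → cl P s U ≐ primeInv P s (prime P s U)
  cl≐primeInv∘prime one = id , id
  cl≐primeInv∘prime ∂   = id , id

  prime∘primeInv≐cl : ∀ {a} s {V : Pred (Z P (bar s)) a} →
                      prime P s (primeInv P s V) ≐ cl P (bar s) V
  prime∘primeInv≐cl one = id , id
  prime∘primeInv≐cl ∂   = id , id

  cl-extensive : ∀ {a} s {U : Pred (Z P s) a} → U ⊆ cl P s U
  cl-extensive one u z U⊥z = U⊥z _ u
  cl-extensive ∂   u z U⊥z = U⊥z _ u

  cl-monotone : ∀ {a b} s {U : Pred (Z P s) a} {V : Pred (Z P s) b} →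
                U ⊆ V → cl P s U ⊆ cl P s V
  cl-monotone one = primeInv-antitone one ∘ prime-antitone one
  cl-monotone ∂   = primeInv-antitone ∂ ∘ prime-antitone ∂

  prime-isGalois : ∀ {a} s {U : Pred (Z P s) a} → IsGalois P (bar s) (prime P s U)
  prime-isGalois one = cl-extensive ∂ , prime-antitone one (cl-extensive one)
  prime-isGalois ∂   = cl-extensive one , prime-antitone ∂ (cl-extensive ∂)

  primeInv-isGalois : ∀ {a} s {V : Pred (Z P (bar s)) a} → IsGalois P s (primeInv P s V)
  primeInv-isGalois one = cl-extensive one , primeInv-antitone one (cl-extensive ∂)
  primeInv-isGalois ∂   = cl-extensive ∂ , primeInv-antitone ∂ (cl-extensive one)

  cl-isGalois : ∀ {a} s {U : Pred (Z P s) a} → IsGalois P s (cl P s U)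
  cl-isGalois one = primeInv-isGalois one
  cl-isGalois ∂   = primeInv-isGalois ∂

  cl-least : ∀ {a b} s {U : Pred (Z P s) a} {A : Pred (Z P s) b} →
             U ⊆ A → IsGalois P s A → cl P s U ⊆ A
  cl-least s U⊆A A-galois = proj₂ A-galois ∘ cl-monotone s U⊆A

  principal : (s : Sort) → Z P s → Pred (Z P s) 0ℓ
  principal s u = cl P s ｛ u ｝

  principal-least : ∀ {b} s {A : Pred (Z P s) b} {u : Z P s} →
                    IsGalois P s A → A u → principal s u ⊆ A
  principal-least s A-galois u∈A = cl-least s (λ { refl → u∈A }) A-galois

module _ (P : Polarity) {n : ℕ} (out : Sort) (is : Fin n → Sort)
         (R : Z P out → ((j : Fin n) → Z P (is j)) → Set) where
  open WithRelation P out is R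

  IsGaloisTuple : Tuple → Set
  IsGaloisTuple F = ∀ j → IsGalois P (is j) (F j)

  IsGaloisAwayFrom : Fin n → Tuple → Set
  IsGaloisAwayFrom k F = ∀ j → j ≢ k → IsGalois P (is j) (F j)

  αbar-mono : {W W′ : Tuple} → (∀ j → W j ⊆ W′ j) → αbar W ⊆ αbar W′
  αbar-mono W⊆W′ = cl-monotone P out λ { (ws , ws∈W , r) → ws , (λ j → W⊆W′ j (ws∈W j)) , r }

  module _ (k : Fin n) where

    γbar-isGalois : ∀ F E → IsGalois P (bar (is k)) (γbar k F E)
    γbar-isGalois F E = cl-extensive P (bar (is k))
                      , λ z∈clγ A A-galois A-ok →
                          proj₂ A-galois (cl-monotone P (bar (is k)) (λ z∈γ → z∈γ A A-galois A-ok) z∈clγ)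

    γbar-upd : ∀ F H E → γbar k (upd F k H) E ⊆ γbar k F E
    γbar-upd F H E z∈γ A A-galois A-ok =
      z∈γ A A-galois (A-ok ∘ αbar-mono (upd-pointwise (λ _ U V → U ⊆ V) k (upd-away-⊆ F k H) id))

    βbar-isGalois : ∀ F G → IsGalois P (is k) (βbar k F G)
    βbar-isGalois F G = primeInv-isGalois P (is k)

    αbar⊆⇒⊆βbar : ∀ F {H G} → IsGalois P (is k) H → αbar (upd F k H) ⊆ G → H ⊆ βbar k F G
    αbar⊆⇒⊆βbar F {H} {G} H-galois αH⊆G =
      Equivalence.to (galois-connection P (is k))
        λ z∈γ → z∈γ (prime P (is k) H) (prime-isGalois P (is k))
                    ( proj₁ (cl≐primeInv∘prime P out) ∘ cl-extensive P out ∘ αH⊆G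
                    ∘ αbar-mono (upd-mono F k (proj₂ H-galois ∘ proj₂ (cl≐primeInv∘prime P (is k)))))

    -- The half of the residuation law that can fail. βbar lives one universe up, so it cannot
    -- itself be put at place k; the law is therefore stated for every Galois H below it.
    Counit : Set₁
    Counit = ∀ F → IsGaloisAwayFrom k F → ∀ H → IsGalois P (is k) H →
             ∀ G → IsGalois P out G → H ⊆ βbar k F G → αbar (upd F k H) ⊆ G

    IsResidual⇔Counit : IsResidual k ⇔ Counit
    IsResidual⇔Counit = mk⇔
      (λ (_ , law) F F-galois H H-galois G G-galois →
         Equivalence.from (law F F-galois H H-galois G G-galois))
      (λ counit → (λ F _ G _ → βbar-isGalois F G)
                , λ F F-galois H H-galois G G-galois →
                    mk⇔ (αbar⊆⇒⊆βbar F H-galois) (counit F F-galois H H-galois G G-galois))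

    IsConjugate⇔Counit : IsConjugate k ⇔ Counit
    IsConjugate⇔Counit = mk⇔ conjugate⇒counit counit⇒conjugate
      where
      conjugate⇒counit : IsConjugate k → Counit
      conjugate⇒counit (_ , law) F F-galois H H-galois G G-galois H⊆β =
        Equivalence.from (law (upd F k H) F[H]-galois G G-galois)
          (subst (λ U → γbar k (upd F k H) (prime P out G) ⊆ prime P (is k) U) (sym (upd-updates F k H))
                 (λ z∈γ → Equivalence.from (galois-connection P (is k)) H⊆β (γbar-upd F H _ z∈γ)))
        where
        F[H]-galois : IsGaloisTuple (upd F k H)
        F[H]-galois = upd-elim (λ j U → IsGalois P (is j) U) k F-galois H-galois

      counit⇒conjugate : Counit → IsConjugate k
      counit⇒conjugate counit = (λ F _ E _ → γbar-isGalois F E) , law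
        where
        law : ∀ F → IsGaloisTuple F → ∀ G → IsGalois P out G →
              (αbar F ⊆ G) ⇔ (γbar k F (prime P out G) ⊆ prime P (is k) (F k))
        law F F-galois G G-galois = mk⇔ to from
          where
          to : αbar F ⊆ G → γbar k F (prime P out G) ⊆ prime P (is k) (F k)
          to αF⊆G = Equivalence.from (galois-connection P (is k))
                      (αbar⊆⇒⊆βbar F (F-galois k) (λ a → αF⊆G (αbar-mono (upd-self-⊆ F k) a)))

          from : γbar k F (prime P out G) ⊆ prime P (is k) (F k) → αbar F ⊆ G
          from γ⊆Fk′ a = counit F (λ j _ → F-galois j) (F k) (F-galois k) G G-galois
                            (Equivalence.to (galois-connection P (is k)) γ⊆Fk′)
                            (αbar-mono (upd-self-⊇ F k) a)

    ⋁-αbar⊆αbar-⋁ : ∀ F {T} (Gs : T → Pred (Z P (is k)) 0ℓ) →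
                    ⋁ P out (λ t → αbar (upd F k (Gs t))) ⊆ αbar (upd F k (⋁ P (is k) Gs))
    ⋁-αbar⊆αbar-⋁ F Gs =
      cl-least P out (λ { (t , a) → αbar-mono (upd-mono F k (λ x → cl-extensive P (is k) (t , x))) a })
                     (cl-isGalois P out)

    Counit⇒Distributes : Counit → Distributes k
    Counit⇒Distributes counit F F-galois T Gs Gs-galois =
        counit F F-galois (⋁ P (is k) Gs) (cl-isGalois P (is k)) J (cl-isGalois P out) ⋁Gs⊆β
      , ⋁-αbar⊆αbar-⋁ F Gs
      where
      J : Pred (Z P out) 0ℓ
      J = ⋁ P out (λ t → αbar (upd F k (Gs t)))

      ⋁Gs⊆β : ⋁ P (is k) Gs ⊆ βbar k F J
      ⋁Gs⊆β = cl-least P (is k)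
                (λ { (t , x) → αbar⊆⇒⊆βbar F (Gs-galois t) (λ a → cl-extensive P out (t , a)) x })
                (βbar-isGalois F J)

    SentInto : Tuple → Pred (Z P out) 0ℓ → Pred (Z P (is k)) 0ℓ
    SentInto F G u = αbar (upd F k (principal P (is k) u)) ⊆ G

    βbar⊆cl-SentInto : ∀ F {G} → IsGalois P out G → βbar k F G ⊆ cl P (is k) (SentInto F G)
    βbar⊆cl-SentInto F {G} G-galois =
      proj₂ (cl≐primeInv∘prime P (is k)) ∘ primeInv-antitone P (is k) sent′⊆γ
      where
      sent′⊆γ : prime P (is k) (SentInto F G) ⊆ γbar k F (prime P out G)
      sent′⊆γ z∈sent′ A A-galois A-ok =
        proj₂ A-galois (proj₁ (prime∘primeInv≐cl P (is k))
                                (prime-antitone P (is k) A′⊆sent z∈sent′))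
        where
        A′⊆sent : primeInv P (is k) A ⊆ SentInto F G
        A′⊆sent u∈A′ = proj₂ G-galois ∘ proj₂ (cl≐primeInv∘prime P out) ∘ A-ok
                     ∘ αbar-mono (upd-mono F k
                         (principal-least P (is k) (primeInv-isGalois P (is k)) u∈A′))

    -- The join is taken over principal sets rather than over all Galois sets below βbar k F G
    -- because Distributes only admits families indexed by a small type.
    Distributes⇒Counit : Distributes k → Counit
    Distributes⇒Counit distributes F F-galois _ _ G G-galois H⊆β =
        cl-least P out (λ { ((u , u-sent) , a) → u-sent a }) G-galois
      ∘ proj₁ (distributes F F-galois (Σ (Z P (is k)) (SentInto F G))
                           (principal P (is k) ∘ proj₁) (λ _ → cl-isGalois P (is k)))
      ∘ αbar-mono (upd-mono F k
          ( cl-monotone P (is k) (λ {u} u-sent → (u , u-sent) , cl-extensive P (is k) refl)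
          ∘ βbar⊆cl-SentInto F G-galois ∘ H⊆β))

    Distributes⇔Counit : Distributes k ⇔ Counit
    Distributes⇔Counit = mk⇔ Distributes⇒Counit Counit⇒Distributes

lemma3p11 : (P : Polarity) {n : ℕ} (out : Sort) (is : Fin n → Sort)
            (R : Z P out → ((j : Fin n) → Z P (is j)) → Set) (k : Fin n) →
            let open WithRelation P out is R in
            (Distributes k ⇔ IsConjugate k) × (Distributes k ⇔ IsResidual k)
lemma3p11 P out is R k =
    ⇔-sym (IsConjugate⇔Counit P out is R k) ⇔-∘ Distributes⇔Counit P out is R k
  , ⇔-sym (IsResidual⇔Counit P out is R k) ⇔-∘ Distributes⇔Counit P out is R k
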